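{- Let $p$ be a prime. For every integer $k\ge 0$ the sequence $(a_p(k,n)\bmod p)_{n=0}^{\infty}$ is $p$-automatic.
   Context: $a_p(k,n)$ is the number of partitions of $n$ into exactly $k$ parts, each a power of $p$. For an integer $q\ge2$, a sequence $\mathbf{a}=(a_n)_{n\ge0}$ is $q$-automatic if its $q$-kernel $\{(a_{q^in+j})_{n\ge0}: i\ge0,\ 0\le j<q^i\}$ is a finite set. -}

module Defs where

open import Data.Nat using (ℕ; zero; suc; _+_; _*_; _^_; _<_; _%_)
open import Data.Nat.Primality using (Prime; prime⇒nonZero)
open import Data.List using (List; []; _∷_; [_]; map; concatMap; upTo; filter; length)
open import Data.Nat.ListAction using (sum)
open import Data.List.Relation.Unary.Any using (Any)
open import Data.Product using (∃)
open import Data.Nat using (_≟_)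
open import Relation.Binary.PropositionalEquality using (_≡_)

-- A partition into k powers of p is encoded by its
-- non-increasing list of exponents (parts p^e₁ ≥ … ≥ p^eₖ).
decExps : ℕ → ℕ → List (List ℕ)
decExps zero    m = [ [] ]
decExps (suc k) m = concatMap (λ e → map (e ∷_) (decExps k e)) (upTo (suc m))

-- For p ≥ 2 every part p^e ≤ n has e < p^e ≤ n,
-- so restricting exponents to ≤ n loses no partition.
a : ℕ → ℕ → ℕ → ℕ
a p k n = length (filter (λ es → sum (map (p ^_) es) ≟ n) (decExps k n))

aModP : (p : ℕ) → Prime p → ℕ → ℕ → ℕ
aModP p pp k n = _%_ (a p k n) p {{prime⇒nonZero pp}}

-- The q-kernel of s is {(s (q^i n + j))_n : i ≥ 0, 0 ≤ j < q^i}.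
FiniteKernel : ℕ → (ℕ → ℕ) → Set
FiniteKernel q s =
  ∃ λ (L : List (ℕ → ℕ)) →
    ∀ i j → j < q ^ i → Any (λ f → ∀ n → s (q ^ i * n + j) ≡ f n) L

IsAutomatic : ℕ → (ℕ → ℕ) → Set
IsAutomatic q s = FiniteKernel q s

module Submission where

-- Write aShift i d n for the number of partitions of n ∸ d into exactly i powers of p
-- (0 when n < d), so that a_p(k, n) = aShift k 0 n.  Separating the j parts equal to 1
-- from the others, which are p times a partition into i − j powers of p, gives
--   aShift i d (pN + r) = Σ_{j ≤ i, j + d ≡ r (mod p)} aShift (i − j) ⌊(j + d)/p⌋ N.
-- As p ≥ 2, the new indices stay ≤ k when i, d ≤ k.  Hence the ℕ-linear span of the
-- (k+1)² sequences aShift i d with i, d ≤ k contains a_p(k, ·) and is closed under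
-- n ↦ pn + r, so every element of the p-kernel of a_p(k, ·) is an ℕ-combination of
-- them.  Modulo p only the coefficients modulo p matter, which leaves finitely many
-- sequences.

open import Defs
open import Data.Nat using (ℕ; zero; suc; _+_; _*_; _^_; _∸_; _<_; _≤_; _%_; _/_; _≟_; z≤n; s≤s; s≤s⁻¹)
open import Data.Nat using (NonZero; NonTrivial; nonTrivial⇒nonZero; nonTrivial⇒n>1)
open import Data.Nat.Properties
open import Data.Nat.DivMod
open import Data.Nat.Divisibility using (m∣m*n)
open import Data.Nat.Primality using (Prime; prime⇒nonZero; prime⇒nonTrivial)
open import Data.Fin as Fin using (Fin; toℕ; fromℕ<; combine; remQuot)
open import Data.Fin.Properties using (toℕ≤pred[n]; toℕ-fromℕ<; remQuot-combine)
open import Data.Vec.Functional as Vector using (Vector)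
open import Data.List using (List; []; _∷_; [_]; _++_; map; concatMap; upTo; applyUpTo; replicate; filter; length)
open import Data.List using (cartesianProductWith)
open import Data.List.Properties using (map-++; map-∘)
open import Data.Nat.ListAction using () renaming (sum to listSum)
open import Data.Nat.ListAction.Properties using (sum-++)
open import Data.List.Relation.Unary.Any as Any using (Any; here)
open import Data.List.Relation.Unary.Any.Properties using (map⁺; cartesianProductWith⁺)
open import Data.List.Membership.Propositional.Properties using (∈-upTo⁺)
open import Data.Product using (∃; _,_; _×_; proj₁; proj₂)
open import Function using (_∘_; id)
open import Relation.Binary.PropositionalEquality using (_≡_; _≢_; refl; sym; trans; cong; cong₂; subst)
open import Relation.Binary.PropositionalEquality using (module ≡-Reasoning)
open import Relation.Nullary using (Dec; does; yes; no; ¬_; contradiction)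
open import Data.Bool using (true; false; if_then_else_)
open import Algebra.Properties.Semiring.Sum +-*-semiring
open import Data.Nat.Tactic.RingSolver using (solve-∀)

𝟙 : ∀ {a} {A : Set a} → Dec A → ℕ
𝟙 a? = if does a? then 1 else 0

𝟙-no : ∀ {a} {A : Set a} → ¬ A → (a? : Dec A) → 𝟙 a? ≡ 0
𝟙-no ¬a (yes a) = contradiction a ¬a
𝟙-no ¬a (no _)  = refl

𝟙-× : ∀ {a b c} {A : Set a} {B : Set b} {C : Set c} → (A → B × C) → (B → C → A) →
      (a? : Dec A) (b? : Dec B) (c? : Dec C) → 𝟙 a? ≡ 𝟙 b? * 𝟙 c?
𝟙-× to from (yes _) (yes _) (yes _) = refl
𝟙-× to from (yes a) (no ¬b) _       = contradiction (proj₁ (to a)) ¬b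
𝟙-× to from (yes a) (yes _) (no ¬c) = contradiction (proj₂ (to a)) ¬c
𝟙-× to from (no ¬a) (yes b) (yes c) = contradiction (from b c) ¬a
𝟙-× to from (no _)  (yes _) (no _)  = refl
𝟙-× to from (no _)  (no _)  _       = refl

length-filter≡sum-𝟙 : ∀ {a ℓ} {A : Set a} {P : A → Set ℓ} (P? : ∀ x → Dec (P x)) xs →
                      length (filter P? xs) ≡ listSum (map (𝟙 ∘ P?) xs)
length-filter≡sum-𝟙 P? []       = refl
length-filter≡sum-𝟙 P? (x ∷ xs) with does (P? x)
... | true  = cong suc (length-filter≡sum-𝟙 P? xs)
... | false = length-filter≡sum-𝟙 P? xs

sum-select : ∀ {N} (t : Fin N) (v : Vector ℕ N) → ∑[ s < N ] (𝟙 (s Fin.≟ t) * v s) ≡ v t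
sum-select {suc N} Fin.zero    v =
  trans (cong (v Fin.zero + 0 +_) (sum-replicate-zero N)) (trans (+-identityʳ _) (+-identityʳ _))
sum-select {suc N} (Fin.suc t) v = sum-select t (v ∘ Fin.suc)

[m%d*n]%d≡[m*n]%d : ∀ m n d .{{_ : NonZero d}} → (m % d * n) % d ≡ (m * n) % d
[m%d*n]%d≡[m*n]%d m n d = begin
  (m % d * n) % d            ≡⟨ %-distribˡ-* (m % d) n d ⟩
  (m % d % d * (n % d)) % d  ≡⟨ cong (λ x → (x * (n % d)) % d) (m%n%n≡m%n m d) ⟩
  (m % d * (n % d)) % d      ≡⟨ %-distribˡ-* m n d ⟨
  (m * n) % d                ∎
  where open ≡-Reasoning

sum-%-cong : ∀ d .{{_ : NonZero d}} {N} (u v : Vector ℕ N) →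
             (∀ t → u t % d ≡ v t % d) → sum u % d ≡ sum v % d
sum-%-cong d {zero}  u v u≡v = refl
sum-%-cong d {suc N} u v u≡v = begin
  sum u % d                                          ≡⟨ %-distribˡ-+ (u Fin.zero) _ d ⟩
  (u Fin.zero % d + sum (u ∘ Fin.suc) % d) % d       ≡⟨ cong₂ (λ x y → (x + y) % d) (u≡v Fin.zero)
                                                          (sum-%-cong d (u ∘ Fin.suc) (v ∘ Fin.suc) (u≡v ∘ Fin.suc)) ⟩
  (v Fin.zero % d + sum (v ∘ Fin.suc) % d) % d       ≡⟨ %-distribˡ-+ (v Fin.zero) _ d ⟨
  sum v % d                                          ∎
  where open ≡-Reasoning

vectorsBelow : ℕ → (N : ℕ) → List (Vector ℕ N)
vectorsBelow m zero    = [ Vector.[] ]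
vectorsBelow m (suc N) = cartesianProductWith Vector._∷_ (upTo m) (vectorsBelow m N)

residues∈vectorsBelow : ∀ m .{{_ : NonZero m}} {N} (c : Vector ℕ N) →
                        Any (λ c′ → ∀ t → c t % m ≡ c′ t) (vectorsBelow m N)
residues∈vectorsBelow m {zero}  c = here (λ ())
residues∈vectorsBelow m {suc N} c =
  cartesianProductWith⁺ Vector._∷_ (λ c₀%m≡x c′%m≗v → λ { Fin.zero → c₀%m≡x ; (Fin.suc t) → c′%m≗v t })
    (∈-upTo⁺ (m%n<n (c Fin.zero) m)) (residues∈vectorsBelow m (c ∘ Fin.suc))

module LinearSpan {N : ℕ} (basis : Vector (ℕ → ℕ) N) where

  combination : Vector ℕ N → ℕ → ℕ
  combination c n = ∑[ t < N ] (c t * basis t n)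

  Span : (ℕ → ℕ) → Set
  Span f = ∃ λ c → ∀ n → f n ≡ combination c n

  span-resp-≗ : ∀ {f g} → (∀ n → f n ≡ g n) → Span g → Span f
  span-resp-≗ f≗g (c , g≗c) = c , λ n → trans (f≗g n) (g≗c n)

  span-zero : Span (λ _ → 0)
  span-zero = (λ _ → 0) , λ n → sym (sum-replicate-zero N)

  span-+ : ∀ {f g} → Span f → Span g → Span (λ n → f n + g n)
  span-+ {f} {g} (c , f≗c) (c′ , g≗c′) = (λ t → c t + c′ t) , λ n → begin
    f n + g n
      ≡⟨ cong₂ _+_ (f≗c n) (g≗c′ n) ⟩
    combination c n + combination c′ n
      ≡⟨ ∑-distrib-+ (λ t → c t * basis t n) _ ⟨
    ∑[ t < N ] (c t * basis t n + c′ t * basis t n)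
      ≡⟨ sum-cong-≗ (λ t → *-distribʳ-+ (basis t n) (c t) (c′ t)) ⟨
    combination (λ t → c t + c′ t) n ∎
    where open ≡-Reasoning

  span-scale : ∀ a {f} → Span f → Span (λ n → a * f n)
  span-scale a {f} (c , f≗c) = (λ t → a * c t) , λ n → begin
    a * f n                             ≡⟨ cong (a *_) (f≗c n) ⟩
    a * combination c n                 ≡⟨ *-distribˡ-sum a (λ t → c t * basis t n) ⟩
    ∑[ t < N ] (a * (c t * basis t n))  ≡⟨ sum-cong-≗ (λ t → *-assoc a (c t) (basis t n)) ⟨
    combination (λ t → a * c t) n       ∎
    where open ≡-Reasoning

  span-∑ : ∀ {M} (F : Fin M → ℕ → ℕ) → (∀ s → Span (F s)) → Span (λ n → ∑[ s < M ] F s n)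
  span-∑ {zero}  F spans = span-zero
  span-∑ {suc M} F spans = span-+ (spans Fin.zero) (span-∑ (F ∘ Fin.suc) (spans ∘ Fin.suc))

  span-basis : ∀ t → Span (basis t)
  span-basis t = (λ s → 𝟙 (s Fin.≟ t)) , λ n → sym (sum-select t (λ s → basis s n))

  module _ (q : ℕ) .{{_ : NonZero q}}
           (span-digit-closed : ∀ t r → r < q → Span (λ n → basis t (q * n + r))) where

    span-digit : ∀ {f} r → r < q → Span f → Span (λ n → f (q * n + r))
    span-digit {f} r r<q (c , f≗c) =
      span-resp-≗ (λ n → f≗c (q * n + r))
        (span-∑ (λ t n → c t * basis t (q * n + r)) (λ t → span-scale (c t) (span-digit-closed t r r<q)))

    span-kernel : ∀ {f} i j → j < q ^ i → Span f → Span (λ n → f (q ^ i * n + j))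
    span-kernel {f} zero    zero    _        sf = span-resp-≗ (λ n → cong f (trans (+-identityʳ _) (*-identityˡ n))) sf
    span-kernel     zero    (suc j) (s≤s ()) sf
    span-kernel {f} (suc i) j       j<q^i    sf =
      span-resp-≗ (λ n → cong f (kernel-index n))
        (span-digit (j / q ^ i) (m<n*o⇒m/o<n j<q^i) (span-kernel i (j % q ^ i) (m%n<n j (q ^ i)) sf))
      where
      instance
        q^i≢0 : NonZero (q ^ i)
        q^i≢0 = m^n≢0 q i
      regroup : ∀ q Q n r d → q * Q * n + (r + d * Q) ≡ Q * (q * n + d) + r
      regroup = solve-∀
      kernel-index : ∀ n → q ^ suc i * n + j ≡ q ^ i * (q * n + j / q ^ i) + j % q ^ i
      kernel-index n = trans (cong (q ^ suc i * n +_) (m≡m%n+[m/n]*n j (q ^ i)))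
                             (regroup q (q ^ i) n (j % q ^ i) (j / q ^ i))

  module _ (m : ℕ) .{{_ : NonZero m}} where

    residueCombinations : List (ℕ → ℕ)
    residueCombinations = map (λ c n → combination c n % m) (vectorsBelow m N)

    combination-%-cong : ∀ {c c′} → (∀ t → c t % m ≡ c′ t) →
                         ∀ n → combination c n % m ≡ combination c′ n % m
    combination-%-cong {c} c%m≗c′ n = sum-%-cong m _ _ λ t →
      trans (sym ([m%d*n]%d≡[m*n]%d (c t) (basis t n) m)) (cong (λ x → (x * basis t n) % m) (c%m≗c′ t))

    span-%∈residueCombinations : ∀ {f} → Span f → Any (λ g → ∀ n → f n % m ≡ g n) residueCombinations
    span-%∈residueCombinations (c , f≗c) =
      map⁺ (Any.map (λ c%m≗c′ n → trans (cong (_% m) (f≗c n)) (combination-%-cong c%m≗c′ n))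
                    (residues∈vectorsBelow m c))

  span⇒finiteKernel-% : ∀ q .{{_ : NonZero q}} m .{{_ : NonZero m}} →
                        (∀ t r → r < q → Span (λ n → basis t (q * n + r))) →
                        ∀ {f} → Span f → FiniteKernel q (λ n → f n % m)
  span⇒finiteKernel-% q m closed sf =
    residueCombinations m , λ i j j<q^i → span-%∈residueCombinations m (span-kernel q closed i j j<q^i sf)

listSum-map-concatMap : ∀ {a b} {A : Set a} {B : Set b} (w : B → ℕ) (h : A → List B) xs →
                        listSum (map w (concatMap h xs)) ≡ listSum (map (λ x → listSum (map w (h x))) xs)
listSum-map-concatMap w h []       = refl
listSum-map-concatMap w h (x ∷ xs) = begin
  listSum (map w (h x ++ concatMap h xs))                  ≡⟨ cong listSum (map-++ w (h x) _) ⟩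
  listSum (map w (h x) ++ map w (concatMap h xs))          ≡⟨ sum-++ (map w (h x)) _ ⟩
  listSum (map w (h x)) + listSum (map w (concatMap h xs)) ≡⟨ cong (_ +_) (listSum-map-concatMap w h xs) ⟩
  listSum (map w (h x)) + listSum (map (λ x → listSum (map w (h x))) xs) ∎
  where open ≡-Reasoning

listSum-map-applyUpTo : ∀ (F f : ℕ → ℕ) n → listSum (map F (applyUpTo f n)) ≡ ∑[ i < n ] F (f (toℕ i))
listSum-map-applyUpTo F f zero    = refl
listSum-map-applyUpTo F f (suc n) = cong (F (f 0) +_) (listSum-map-applyUpTo F (f ∘ suc) n)

∑-vanishing-tail : ∀ (G : ℕ → ℕ) {n M} → (∀ e → n < e → G e ≡ 0) → n ≤ M →
                   ∑[ e < suc M ] G (toℕ e) ≡ ∑[ e < suc n ] G (toℕ e)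
∑-vanishing-tail G {zero}  {M}     G>n≡0 z≤n =
  cong (G 0 +_) (trans (sum-cong-≗ {M} {y = λ _ → 0} (λ e → G>n≡0 (suc (toℕ e)) (s≤s z≤n)))
                       (sum-replicate-zero M))
∑-vanishing-tail G {suc n} {suc M} G>n≡0 (s≤s n≤M) =
  cong (G 0 +_) (∑-vanishing-tail (G ∘ suc) (λ e n<e → G>n≡0 (suc e) (s≤s n<e)) n≤M)

∑-decExps : ℕ → ℕ → (List ℕ → ℕ) → ℕ
∑-decExps zero    M w = w []
∑-decExps (suc k) M w = ∑[ e < suc M ] ∑-decExps k (toℕ e) (w ∘ (toℕ e ∷_))

listSum-map-decExps : ∀ k M w → listSum (map w (decExps k M)) ≡ ∑-decExps k M w
listSum-map-decExps zero    M w = +-identityʳ (w [])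
listSum-map-decExps (suc k) M w = begin
  listSum (map w (concatMap (λ e → map (e ∷_) (decExps k e)) (upTo (suc M))))
    ≡⟨ listSum-map-concatMap w (λ e → map (e ∷_) (decExps k e)) (upTo (suc M)) ⟩
  listSum (map (λ e → listSum (map w (map (e ∷_) (decExps k e)))) (upTo (suc M)))
    ≡⟨ listSum-map-applyUpTo _ id (suc M) ⟩
  ∑[ e < suc M ] listSum (map w (map (toℕ e ∷_) (decExps k (toℕ e))))
    ≡⟨ sum-cong-≗ {suc M} (λ e → cong listSum (map-∘ {g = w} {f = toℕ e ∷_} (decExps k (toℕ e)))) ⟨
  ∑[ e < suc M ] listSum (map (w ∘ (toℕ e ∷_)) (decExps k (toℕ e)))
    ≡⟨ sum-cong-≗ {suc M} (λ e → listSum-map-decExps k (toℕ e) (w ∘ (toℕ e ∷_))) ⟩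
  ∑-decExps (suc k) M w ∎
  where open ≡-Reasoning

∑-decExps-cong : ∀ k M {w w′} → (∀ es → w es ≡ w′ es) → ∑-decExps k M w ≡ ∑-decExps k M w′
∑-decExps-cong zero    M w≗w′ = w≗w′ []
∑-decExps-cong (suc k) M {w} {w′} w≗w′ =
  sum-cong-≗ {suc M} λ e →
    ∑-decExps-cong k (toℕ e) {w ∘ (toℕ e ∷_)} {w′ ∘ (toℕ e ∷_)} (w≗w′ ∘ (toℕ e ∷_))

∑-decExps-scale : ∀ k M c w → ∑-decExps k M (λ es → c * w es) ≡ c * ∑-decExps k M w
∑-decExps-scale zero    M c w = refl
∑-decExps-scale (suc k) M c w = begin
  ∑[ e < suc M ] ∑-decExps k (toℕ e) (λ es → c * w (toℕ e ∷ es))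
    ≡⟨ sum-cong-≗ {suc M} (λ e → ∑-decExps-scale k (toℕ e) c (w ∘ (toℕ e ∷_))) ⟩
  ∑[ e < suc M ] (c * ∑-decExps k (toℕ e) (w ∘ (toℕ e ∷_)))
    ≡⟨ *-distribˡ-sum {suc M} c (λ e → ∑-decExps k (toℕ e) (w ∘ (toℕ e ∷_))) ⟨
  c * ∑-decExps (suc k) M w ∎
  where open ≡-Reasoning

∑-decExps-zeroWeight : ∀ k M → ∑-decExps k M (λ _ → 0) ≡ 0
∑-decExps-zeroWeight k M = ∑-decExps-scale k M 0 (λ _ → 0)

∑-decExps-zeroBound : ∀ k w → ∑-decExps k 0 w ≡ w (replicate k 0)
∑-decExps-zeroBound zero    w = refl
∑-decExps-zeroBound (suc k) w = trans (+-identityʳ _) (∑-decExps-zeroBound k (w ∘ (0 ∷_)))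

∑-decExps-stable : ∀ k {n M w} → (∀ e es → n < e → w (e ∷ es) ≡ 0) → n ≤ M →
                   ∑-decExps k M w ≡ ∑-decExps k n w
∑-decExps-stable zero    w>n≡0 n≤M = refl
∑-decExps-stable (suc k) {n} {w = w} w>n≡0 n≤M =
  ∑-vanishing-tail (λ e → ∑-decExps k e (w ∘ (e ∷_))) vanish n≤M
  where
  vanish : ∀ e → n < e → ∑-decExps k e (w ∘ (e ∷_)) ≡ 0
  vanish e n<e = trans (∑-decExps-cong k e (λ es → w>n≡0 e es n<e)) (∑-decExps-zeroWeight k e)

-- Multiplies every part by p and adds j parts equal to 1.
raiseAndPad : ℕ → List ℕ → List ℕ
raiseAndPad j es = map suc es ++ replicate j 0

-- A list in decExps k (suc M) with i nonzero exponents is raiseAndPad (k ∸ i) of a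
-- unique list in decExps i M.
∑-decExps-sucBound : ∀ k M w →
                     ∑-decExps k (suc M) w ≡ ∑[ i < suc k ] ∑-decExps (toℕ i) M (w ∘ raiseAndPad (k ∸ toℕ i))
∑-decExps-sucBound zero    M w = sym (+-identityʳ (w []))
∑-decExps-sucBound (suc k) M w = begin
  ∑-decExps k 0 (w ∘ (0 ∷_)) + ∑[ e < suc M ] ∑-decExps k (suc (toℕ e)) (w ∘ (suc (toℕ e) ∷_))
    ≡⟨ cong₂ _+_ (∑-decExps-zeroBound k (w ∘ (0 ∷_)))
                 (sum-cong-≗ {suc M} (λ e → ∑-decExps-sucBound k (toℕ e) (w ∘ (suc (toℕ e) ∷_)))) ⟩
  w (replicate (suc k) 0)
    + ∑[ e < suc M ] ∑[ i < suc k ] ∑-decExps (toℕ i) (toℕ e) (w ∘ raiseAndPad (k ∸ toℕ i) ∘ (toℕ e ∷_))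
    ≡⟨ cong (w (replicate (suc k) 0) +_)
            (∑-comm {suc M} {suc k} (λ e i → ∑-decExps (toℕ i) (toℕ e) (w ∘ raiseAndPad (k ∸ toℕ i) ∘ (toℕ e ∷_)))) ⟩
  ∑[ i < suc (suc k) ] ∑-decExps (toℕ i) M (w ∘ raiseAndPad (suc k ∸ toℕ i)) ∎
  where open ≡-Reasoning

p*u+v-injective : ∀ p .{{_ : NonZero p}} {u v N r} → v < p → r < p →
                  p * u + v ≡ p * N + r → v ≡ r × u ≡ N
p*u+v-injective p {u} {v} {N} {r} v<p r<p eq = v≡r , u≡N
  where
  open ≡-Reasoning
  v≡r : v ≡ r
  v≡r = begin
    v                ≡⟨ m<n⇒m%n≡m v<p ⟨
    v % p            ≡⟨ %-remove-+ˡ v {p} (m∣m*n u) ⟨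
    (p * u + v) % p  ≡⟨ cong (_% p) eq ⟩
    (p * N + r) % p  ≡⟨ %-remove-+ˡ r {p} (m∣m*n N) ⟩
    r % p            ≡⟨ m<n⇒m%n≡m r<p ⟩
    r                ∎
  u≡N : u ≡ N
  u≡N = *-cancelˡ-≡ u N p (+-cancelʳ-≡ v (p * u) (p * N) (trans eq (cong (p * N +_) (sym v≡r))))

p*A+x≡p*[A+x/p]+x%p : ∀ p .{{_ : NonZero p}} A x → p * A + x ≡ p * (A + x / p) + x % p
p*A+x≡p*[A+x/p]+x%p p A x = trans (cong (p * A +_) (m≡m%n+[m/n]*n x p)) (regroup p A (x % p) (x / p))
  where
  regroup : ∀ p A r q → p * A + (r + q * p) ≡ p * (A + q) + r
  regroup = solve-∀

p*A+x≡p*N+r⇒remQuot : ∀ p .{{_ : NonZero p}} {A x N r} → r < p →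
                       p * A + x ≡ p * N + r → x % p ≡ r × A + x / p ≡ N
p*A+x≡p*N+r⇒remQuot p {A} {x} r<p eq =
  p*u+v-injective p (m%n<n x p) r<p (trans (sym (p*A+x≡p*[A+x/p]+x%p p A x)) eq)

𝟙-digit : ∀ p .{{_ : NonZero p}} A x N r → r < p →
          𝟙 (p * A + x ≟ p * N + r) ≡ 𝟙 (x % p ≟ r) * 𝟙 (A + x / p ≟ N)
𝟙-digit p A x N r r<p = 𝟙-× (p*A+x≡p*N+r⇒remQuot p r<p)
  (λ x%p≡r A+x/p≡N → trans (p*A+x≡p*[A+x/p]+x%p p A x) (cong₂ (λ u v → p * u + v) A+x/p≡N x%p≡r))
  (p * A + x ≟ p * N + r) (x % p ≟ r) (A + x / p ≟ N)

module Partitions (p : ℕ) .{{_ : NonTrivial p}} where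

  private instance
    p≢0 : NonZero p
    p≢0 = nonTrivial⇒nonZero p

  2≤p : 2 ≤ p
  2≤p = nonTrivial⇒n>1 p

  n<p^n : ∀ n → n < p ^ n
  n<p^n zero    = s≤s z≤n
  n<p^n (suc n) = begin-strict
    suc n          ≤⟨ n<p^n n ⟩
    p ^ n          <⟨ m<m+n (p ^ n) (m^n>0 p n) ⟩
    p ^ n + p ^ n  ≡⟨ cong (p ^ n +_) (+-identityʳ (p ^ n)) ⟨
    2 * p ^ n      ≤⟨ *-monoˡ-≤ (p ^ n) 2≤p ⟩
    p ^ suc n      ∎
    where open ≤-Reasoning

  powerSum : List ℕ → ℕ
  powerSum es = listSum (map (p ^_) es)

  powerSum-replicate-0 : ∀ j → powerSum (replicate j 0) ≡ j
  powerSum-replicate-0 zero    = refl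
  powerSum-replicate-0 (suc j) = cong suc (powerSum-replicate-0 j)

  powerSum-raiseAndPad : ∀ j es → powerSum (raiseAndPad j es) ≡ p * powerSum es + j
  powerSum-raiseAndPad j []       = trans (powerSum-replicate-0 j) (cong (_+ j) (sym (*-zeroʳ p)))
  powerSum-raiseAndPad j (e ∷ es) = begin
    p * p ^ e + powerSum (raiseAndPad j es)  ≡⟨ cong (p * p ^ e +_) (powerSum-raiseAndPad j es) ⟩
    p * p ^ e + (p * powerSum es + j)         ≡⟨ +-assoc (p * p ^ e) _ j ⟨
    p * p ^ e + p * powerSum es + j           ≡⟨ cong (_+ j) (*-distribˡ-+ p (p ^ e) _) ⟨
    p * powerSum (e ∷ es) + j                 ∎
    where open ≡-Reasoning

  aShift : ℕ → ℕ → ℕ → ℕ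
  aShift i d n = ∑-decExps i n (λ es → 𝟙 (powerSum es + d ≟ n))

  aShift-stable : ∀ i d {n M} → n ≤ M → ∑-decExps i M (λ es → 𝟙 (powerSum es + d ≟ n)) ≡ aShift i d n
  aShift-stable i d {n} n≤M =
    ∑-decExps-stable i (λ e es n<e → 𝟙-no (too-big e es n<e) (powerSum (e ∷ es) + d ≟ n)) n≤M
    where
    too-big : ∀ e es → n < e → powerSum (e ∷ es) + d ≢ n
    too-big e es n<e eq = <⇒≱ (<-trans n<e (n<p^n e))
      (≤-trans (m≤m+n (p ^ e) (powerSum es)) (≤-trans (m≤m+n _ d) (≤-reflexive eq)))

  aShift-digit : ∀ i d N r → r < p →
                 aShift i d (p * N + r) ≡
                 ∑[ i′ < suc i ] (𝟙 ((i ∸ toℕ i′ + d) % p ≟ r) * aShift (toℕ i′) ((i ∸ toℕ i′ + d) / p) N)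
  aShift-digit i d N r r<p = begin
    aShift i d n
      ≡⟨ aShift-stable i d (n≤1+n n) ⟨
    ∑-decExps i (suc n) w
      ≡⟨ ∑-decExps-sucBound i n w ⟩
    ∑[ i′ < suc i ] ∑-decExps (toℕ i′) n (w ∘ raiseAndPad (j i′))
      ≡⟨ sum-cong-≗ {suc i} (λ i′ → ∑-decExps-cong (toℕ i′) n (w-raiseAndPad i′)) ⟩
    ∑[ i′ < suc i ] ∑-decExps (toℕ i′) n (λ es → c i′ * 𝟙 (powerSum es + q i′ ≟ N))
      ≡⟨ sum-cong-≗ {suc i} (λ i′ → ∑-decExps-scale (toℕ i′) n (c i′) (λ es → 𝟙 (powerSum es + q i′ ≟ N))) ⟩
    ∑[ i′ < suc i ] (c i′ * ∑-decExps (toℕ i′) n (λ es → 𝟙 (powerSum es + q i′ ≟ N)))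
      ≡⟨ sum-cong-≗ {suc i} (λ i′ → cong (c i′ *_) (aShift-stable (toℕ i′) (q i′) N≤n)) ⟩
    ∑[ i′ < suc i ] (c i′ * aShift (toℕ i′) (q i′) N) ∎
    where
    open ≡-Reasoning
    n : ℕ
    n = p * N + r
    N≤n : N ≤ n
    N≤n = ≤-trans (m≤n*m N p) (m≤m+n (p * N) r)
    w : List ℕ → ℕ
    w es = 𝟙 (powerSum es + d ≟ n)
    j c q : Fin (suc i) → ℕ
    j i′ = i ∸ toℕ i′
    c i′ = 𝟙 ((j i′ + d) % p ≟ r)
    q i′ = (j i′ + d) / p
    w-raiseAndPad : ∀ i′ es → w (raiseAndPad (j i′) es) ≡ c i′ * 𝟙 (powerSum es + q i′ ≟ N)
    w-raiseAndPad i′ es = begin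
      𝟙 (powerSum (raiseAndPad (j i′) es) + d ≟ n)  ≡⟨ cong (λ m → 𝟙 (m + d ≟ n)) (powerSum-raiseAndPad (j i′) es) ⟩
      𝟙 (p * powerSum es + j i′ + d ≟ n)            ≡⟨ cong (λ m → 𝟙 (m ≟ n)) (+-assoc (p * powerSum es) (j i′) d) ⟩
      𝟙 (p * powerSum es + (j i′ + d) ≟ n)          ≡⟨ 𝟙-digit p (powerSum es) (j i′ + d) N r r<p ⟩
      c i′ * 𝟙 (powerSum es + q i′ ≟ N)             ∎

  a≗aShift : ∀ k n → a p k n ≡ aShift k 0 n
  a≗aShift k n = begin
    a p k n
      ≡⟨ length-filter≡sum-𝟙 (λ es → powerSum es ≟ n) (decExps k n) ⟩
    listSum (map (λ es → 𝟙 (powerSum es ≟ n)) (decExps k n))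
      ≡⟨ listSum-map-decExps k n (λ es → 𝟙 (powerSum es ≟ n)) ⟩
    ∑-decExps k n (λ es → 𝟙 (powerSum es ≟ n))
      ≡⟨ ∑-decExps-cong k n (λ es → cong (λ m → 𝟙 (m ≟ n)) (+-identityʳ (powerSum es))) ⟨
    aShift k 0 n ∎
    where open ≡-Reasoning

  [j+d]/p≤k : ∀ {j d k} → j ≤ k → d ≤ k → (j + d) / p ≤ k
  [j+d]/p≤k {j} {d} {k} j≤k d≤k = s≤s⁻¹ (m<n*o⇒m/o<n {n = suc k} {o = p} (begin-strict
    j + d          ≤⟨ +-mono-≤ j≤k d≤k ⟩
    k + k          <⟨ +-mono-< (n<1+n k) (n<1+n k) ⟩
    suc k + suc k  ≡⟨ cong (suc k +_) (+-identityʳ (suc k)) ⟨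
    2 * suc k      ≤⟨ *-monoˡ-≤ (suc k) 2≤p ⟩
    p * suc k      ≡⟨ *-comm p (suc k) ⟩
    suc k * p      ∎))
    where open ≤-Reasoning

  aShiftBasis : (k : ℕ) → Vector (ℕ → ℕ) (suc k * suc k)
  aShiftBasis k t = let (i , d) = remQuot {suc k} (suc k) t in aShift (toℕ i) (toℕ d)

  module _ (k : ℕ) where
    open LinearSpan (aShiftBasis k)

    aShift∈Span : ∀ {i d} → i ≤ k → d ≤ k → Span (aShift i d)
    aShift∈Span {i} {d} i≤k d≤k = subst Span basis≡aShift (span-basis (combine i′ d′))
      where
      i′ d′ : Fin (suc k)
      i′ = fromℕ< (s≤s i≤k)
      d′ = fromℕ< (s≤s d≤k)
      basis≡aShift : aShiftBasis k (combine i′ d′) ≡ aShift i d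
      basis≡aShift = trans (cong (λ (x , y) → aShift (toℕ x) (toℕ y)) (remQuot-combine i′ d′))
                           (cong₂ aShift (toℕ-fromℕ< (s≤s i≤k)) (toℕ-fromℕ< (s≤s d≤k)))

    aShift-digit∈Span : ∀ {i d r} → i ≤ k → d ≤ k → r < p → Span (λ n → aShift i d (p * n + r))
    aShift-digit∈Span {i} {d} {r} i≤k d≤k r<p =
      span-resp-≗ (λ n → aShift-digit i d n r r<p)
        (span-∑ (λ i′ n → 𝟙 ((i ∸ toℕ i′ + d) % p ≟ r) * aShift (toℕ i′) ((i ∸ toℕ i′ + d) / p) n)
          (λ i′ → span-scale (𝟙 ((i ∸ toℕ i′ + d) % p ≟ r))
                    (aShift∈Span (≤-trans (toℕ≤pred[n] i′) i≤k) ([j+d]/p≤k (≤-trans (m∸n≤m i (toℕ i′)) i≤k) d≤k))))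

    a-mod-automatic : ∀ m .{{_ : NonZero m}} → IsAutomatic p (λ n → a p k n % m)
    a-mod-automatic m =
      span⇒finiteKernel-% p m
        (λ t r r<p → let (i , d) = remQuot {suc k} (suc k) t in
                     aShift-digit∈Span (toℕ≤pred[n] i) (toℕ≤pred[n] d) r<p)
        (span-resp-≗ (a≗aShift k) (aShift∈Span ≤-refl z≤n))

corollary6p6 : (p : ℕ) (pp : Prime p) (k : ℕ) → IsAutomatic p (aModP p pp k)
corollary6p6 p pp k = Partitions.a-mod-automatic p {{prime⇒nonTrivial pp}} k p {{prime⇒nonZero pp}}
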